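{- Let $M[P,Q]$ have rank $r$ and nullity $m$. Every nontrivial connected flat $X$ of $M[P,Q]$ is an interval in $[m+r]$, and $n(X)$ is an interval of $r(X)$ elements in $[r]$.
   Context: Lattice paths start at $(0,0)$ and use steps $E=(1,0)$ and $N=(0,1)$. For lattice paths $P,Q$ from $(0,0)$ to $(m,r)$ with $P$ never going above $Q$, let $\mathcal{P}$ be the set of lattice paths from $(0,0)$ to $(m,r)$ going neither above $Q$ nor below $P$, and for $1\le i\le r$ let $N_i=\{j:\text{step } j \text{ is the } i\text{ -th North step of some path in }\mathcal{P}\}$. $M[P,Q]$ is the transversal matroid on $[m+r]$ with presentation $(N_1,\ldots,N_r)$; its incidence function is $n(X)=\{i\in[r]: X\cap N_i\neq\emptyset\}$. A flat $X$ is connected if $M|X$ is connected, and nontrivial if $X$ is dependent. -}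

module Defs where

open import Data.Nat using (ℕ; zero; suc; _+_; _≤_; _<_)
open import Data.Bool using (Bool; true; false; if_then_else_)
open import Data.Vec using (Vec; []; _∷_; lookup)
open import Data.Fin using (Fin; toℕ)
open import Data.Fin.Subset using (Subset; _∈_; _∉_; _⊆_; _∪_; _-_; ⁅_⁆; ∣_∣)
open import Data.Product using (Σ; ∃; ∃-syntax; _×_; _,_)
open import Relation.Nullary using (¬_)
open import Relation.Binary.PropositionalEquality using (_≡_; _≢_)
open import Function.Bundles using (_⇔_)

-- A lattice path with n steps is a word in {E,N}^n; true = N (North), false = E (East).
-- ups v k = number of North steps among the first k steps of v (= height after k steps).
ups : ∀ {n} → Vec Bool n → ℕ → ℕ
ups []      k       = 0
ups (b ∷ v) zero    = 0
ups (b ∷ v) (suc k) = (if b then 1 else 0) + ups v k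

-- v is a lattice path from (0,0) to (m,r): m+r steps, exactly r of them North.
IsPath : (m r : ℕ) → Vec Bool (m + r) → Set
IsPath m r v = ups v (m + r) ≡ r

NotAbove : ∀ {n} → Vec Bool n → Vec Bool n → Set
NotAbove P Q = ∀ k → ups P k ≤ ups Q k

InRegion : (m r : ℕ) → (P Q R : Vec Bool (m + r)) → Set
InRegion m r P Q R = IsPath m r R × NotAbove P R × NotAbove R Q

-- Step j (0-indexed) of R is the i-th North step (0-indexed).
IthNorth : ∀ {n} → Vec Bool n → Fin n → ℕ → Set
IthNorth R j i = lookup R j ≡ true × ups R (toℕ j) ≡ i

-- j ∈ N_i   (i ∈ Fin r, 0-indexed: i corresponds to N_{i+1} of the paper)
InN : (m r : ℕ) → (P Q : Vec Bool (m + r)) → Fin r → Fin (m + r) → Set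
InN m r P Q i j = ∃[ R ] (InRegion m r P Q R × IthNorth R j (toℕ i))

module LPM (m r : ℕ) (P Q : Vec Bool (m + r)) where

  E : ℕ
  E = m + r

  -- Independent sets of the transversal matroid M[P,Q] with presentation (N_1,…,N_r):
  -- partial transversals, i.e. I admits an injective assignment f into [r] with x ∈ N_{f x}.
  Indep : Subset E → Set
  Indep I = Σ ((x : Fin E) → x ∈ I → Fin r) λ f →
              ((∀ x (x∈I : x ∈ I) → InN m r P Q (f x x∈I) x)
             × (∀ x y (x∈I : x ∈ I) (y∈I : y ∈ I) → f x x∈I ≡ f y y∈I → x ≡ y))

  Dependent : Subset E → Set
  Dependent X = ¬ Indep X

  IsRank : Subset E → ℕ → Set
  IsRank X k = (∃[ I ] (I ⊆ X × Indep I × ∣ I ∣ ≡ k))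
             × (∀ I → I ⊆ X → Indep I → ∣ I ∣ ≤ k)

  IsFlat : Subset E → Set
  IsFlat X = ∀ e → e ∉ X → ∀ k k′ → IsRank X k → IsRank (X ∪ ⁅ e ⁆) k′ → k < k′

  IsCircuit : Subset E → Set
  IsCircuit C = Dependent C × (∀ e → e ∈ C → Indep (C - e))

  -- M|X is connected: any two distinct elements of X lie in a common circuit of M|X
  -- (the circuits of M|X are the circuits of M contained in X).
  Connected : Subset E → Set
  Connected X = ∀ x y → x ∈ X → y ∈ X → x ≢ y →
                ∃[ C ] (C ⊆ X × IsCircuit C × x ∈ C × y ∈ C)

  InIncidence : Subset E → Fin r → Set
  InIncidence X i = ∃[ j ] (j ∈ X × InN m r P Q i j)

  IsInterval : Subset E → Set
  IsInterval X = ∃[ a ] ∃[ b ] (∀ j → (j ∈ X) ⇔ (a ≤ toℕ j × toℕ j ≤ b))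

  IncidenceIntervalOfSize : Subset E → ℕ → Set
  IncidenceIntervalOfSize X k =
    ∃[ a ] (∀ (i : Fin r) → InIncidence X i ⇔ (a ≤ toℕ i × toℕ i < a + k))

{-# OPTIONS --safe #-}

-- Step j can be the i-th North step of a path between P and Q exactly when β j ≤ i < α j, where
-- β j is the height of P before step j and α j the height of Q after it. Both are monotone in j,
-- so M[P,Q] is the transversal matroid of a family of intervals with monotone endpoints, and for
-- such families Hall's condition only has to be checked on windows: a set is dependent iff some
-- subset T has all its intervals inside a window of fewer than |T| indices.
--
-- Let x and y be the least and greatest elements of X, and C a circuit of M|X through both
-- (from connectivity, or the loop C = {x} if x = y). If some i with β x ≤ i < α y were missing from n(C),
-- the parts of C below and above i would have disjoint transversals taken from C - y and C - x,
-- making C independent; so n(C) = [β x, α y). A circuit is an overfull window, which gives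
-- |C - x| ≥ α y - β x, while no independent set inside [x, y] is larger than that. Hence every set
-- between C and [x, y] has rank α y - β x, flatness puts all of [x, y] into X, and
-- n(X) = [β x, α y) has exactly r(X) elements.

module Submission where

open import Defs
open import Data.Bool using (Bool; true; false; if_then_else_)
open import Data.Empty using (⊥-elim)
open import Data.Fin as Fin using (Fin; toℕ; fromℕ<; punchOut)
open import Data.Fin.Properties as Finₚ using (toℕ-fromℕ<; toℕ-injective; toℕ<n; any?; punchOut-injective)
open import Data.Fin.Subset using (Subset; _∈_; _∉_; _⊆_; _∪_; _-_; ⁅_⁆; ∣_∣; Nonempty)
open import Data.Fin.Subset.Properties
  using (_∈?_; nonempty?; Empty-unique; ∉⊥; x∈⁅x⁆; x∈⁅y⁆⇒x≡y; x∈p∧x≢y⇒x∈p-y; p⊆p∪q; x∈p∪q⁻; p─q⊆p; p─⊥≡p;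
         p⊆q⇒∣p∣≤∣q∣; ∣⊥∣≡0)
open import Data.Nat using (ℕ; zero; suc; _+_; _∸_; _⊓_; _⊔_; _≤_; _<_; _≰_; z≤n; s≤s; s≤s⁻¹; z<s; _≟_; _≤?_; _<?_)
open import Data.Nat.Properties
open import Data.Product as Product using (_×_; _,_; proj₁; proj₂; ∃₂; ∃-syntax)
open import Data.Sum as Sum using (_⊎_; inj₁; inj₂)
open import Data.Vec using (Vec; []; _∷_; lookup; tabulate; here; there)
open import Data.Vec.Properties using (lookup∘tabulate)
open import Function using (_∘_; id)
open import Function.Bundles using (_⇔_; mk⇔; Equivalence)
open import Relation.Binary.Core using (_Preserves_⟶_)
open import Relation.Binary.PropositionalEquality
  using (_≡_; _≢_; refl; sym; trans; cong; cong₂; subst; subst₂; module ≡-Reasoning)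
open import Relation.Nullary using (¬_; Dec; yes; no; does)
open import Relation.Nullary.Decidable using (map′; _×-dec_; dec-true)

[1+m]∸n≤1+[m∸n] : ∀ m n → suc m ∸ n ≤ suc (m ∸ n)
[1+m]∸n≤1+[m∸n] m       zero    = ≤-refl
[1+m]∸n≤1+[m∸n] zero    (suc n) = ≤-trans (m∸n≤m 0 n) z≤n
[1+m]∸n≤1+[m∸n] (suc m) (suc n) = [1+m]∸n≤1+[m∸n] m n

m≤n⊔o∧m≰n⇒m≤o : ∀ {m n o} → m ≤ n ⊔ o → m ≰ n → m ≤ o
m≤n⊔o∧m≰n⇒m≤o {m} {n} {o} m≤n⊔o m≰n with ≤-total n o
... | inj₁ n≤o = subst (m ≤_) (m≤n⇒m⊔n≡n n≤o) m≤n⊔o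
... | inj₂ o≤n = ⊥-elim (m≰n (subst (m ≤_) (m≥n⇒m⊔n≡m o≤n) m≤n⊔o))

m≤o≤n⇒n⊓[m⊔o]≡o : ∀ {m n o} → m ≤ o → o ≤ n → n ⊓ (m ⊔ o) ≡ o
m≤o≤n⇒n⊓[m⊔o]≡o m≤o o≤n = trans (cong (_ ⊓_) (m≤n⇒m⊔n≡n m≤o)) (m≥n⇒m⊓n≡n o≤n)

m≤o⇒[o<n⇔o<m+[n∸m]] : ∀ {m n o} → m ≤ o → (o < n ⇔ o < m + (n ∸ m))
m≤o⇒[o<n⇔o<m+[n∸m]] {m} {n} {o} m≤o with ≤-total m n
... | inj₁ m≤n rewrite m+[n∸m]≡n m≤n = mk⇔ id id
... | inj₂ n≤m = mk⇔ (λ o<n → ⊥-elim (<⇒≱ o<n (≤-trans n≤m m≤o)))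
                     (λ o<m+[n∸m] → ⊥-elim (<⇒≱ (subst (o <_) m+[n∸m]≡m o<m+[n∸m]) m≤o))
  where
    m+[n∸m]≡m : m + (n ∸ m) ≡ m
    m+[n∸m]≡m = trans (cong (m +_) (m≤n⇒m∸n≡0 n≤m)) (+-identityʳ m)

UnitStep : ℕ → ℕ → Set
UnitStep a b = a ≤ b × b ≤ suc a

⊓-unitStep : ∀ {a a′ b b′} → UnitStep a a′ → UnitStep b b′ → UnitStep (a ⊓ b) (a′ ⊓ b′)
⊓-unitStep (a≤a′ , a′≤1+a) (b≤b′ , b′≤1+b) = ⊓-mono-≤ a≤a′ b≤b′ , ⊓-mono-≤ a′≤1+a b′≤1+b

⊔-unitStep : ∀ {a a′ b b′} → UnitStep a a′ → UnitStep b b′ → UnitStep (a ⊔ b) (a′ ⊔ b′)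
⊔-unitStep (a≤a′ , a′≤1+a) (b≤b′ , b′≤1+b) = ⊔-mono-≤ a≤a′ b≤b′ , ⊔-mono-≤ a′≤1+a b′≤1+b

bit : Bool → ℕ
bit b = if b then 1 else 0

unitStep-bit : ∀ {a b} → UnitStep a b → (up? : Dec (b ≡ suc a)) → a + bit (does up?) ≡ b
unitStep-bit {a} _             (yes b≡1+a) = trans (+-comm a 1) (sym b≡1+a)
unitStep-bit {a} (a≤b , b≤1+a) (no  b≢1+a) =
  trans (+-identityʳ a) (≤-antisym a≤b (s≤s⁻¹ (≤∧≢⇒< b≤1+a b≢1+a)))

∣p∣≤1+∣p-x∣ : ∀ {n} (p : Subset n) (x : Fin n) → ∣ p ∣ ≤ suc ∣ p - x ∣
∣p∣≤1+∣p-x∣ (b ∷ p) Fin.zero = subst (λ q → ∣ b ∷ p ∣ ≤ suc ∣ q ∣) (sym (p─⊥≡p p)) (∣b∷p∣≤1+∣p∣ b)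
  where
    ∣b∷p∣≤1+∣p∣ : ∀ b → ∣ b ∷ p ∣ ≤ suc ∣ p ∣
    ∣b∷p∣≤1+∣p∣ true  = ≤-refl
    ∣b∷p∣≤1+∣p∣ false = n≤1+n ∣ p ∣
∣p∣≤1+∣p-x∣ (true  ∷ p) (Fin.suc x) = s≤s (∣p∣≤1+∣p-x∣ p x)
∣p∣≤1+∣p-x∣ (false ∷ p) (Fin.suc x) = ∣p∣≤1+∣p-x∣ p x

0<∣p∣⇒Nonempty : ∀ {n} {p : Subset n} → 0 < ∣ p ∣ → Nonempty p
0<∣p∣⇒Nonempty {n} {p} 0<∣p∣ with nonempty? p
... | yes p≢∅ = p≢∅
... | no  p≡∅ = ⊥-elim (<-irrefl (sym (trans (cong ∣_∣ (Empty-unique p≡∅)) (∣⊥∣≡0 n))) 0<∣p∣)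

x∉p-x : ∀ {n} (p : Subset n) (x : Fin n) → x ∉ p - x
x∉p-x (_ ∷ p) (Fin.suc x) (there x∈p-x) = x∉p-x p x x∈p-x

injection⇒∣p∣≤n : ∀ {n k} {p : Subset n} (f : ∀ {x} → x ∈ p → Fin k) →
                  (∀ {x y} (x∈p : x ∈ p) (y∈p : y ∈ p) → f x∈p ≡ f y∈p → x ≡ y) → ∣ p ∣ ≤ k
injection⇒∣p∣≤n {p = []}        f inj = z≤n
injection⇒∣p∣≤n {p = false ∷ p} f inj =
  injection⇒∣p∣≤n (f ∘ there) λ x∈p y∈p e → Finₚ.suc-injective (inj (there x∈p) (there y∈p) e)
injection⇒∣p∣≤n {k = zero}  {p = true ∷ p} f inj with () ← f here
injection⇒∣p∣≤n {k = suc k} {p = true ∷ p} f inj =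
  s≤s (injection⇒∣p∣≤n (λ x∈p → punchOut (f₀≢f x∈p)) λ x∈p y∈p e →
        Finₚ.suc-injective (inj (there x∈p) (there y∈p) (punchOut-injective (f₀≢f x∈p) (f₀≢f y∈p) e)))
  where
    f₀≢f : ∀ {x} (x∈p : x ∈ p) → f here ≢ f (there x∈p)
    f₀≢f x∈p e with () ← inj here (there x∈p) e

injection-into-window : ∀ {n} {p : Subset n} {lo hi} (f : ∀ {x} → x ∈ p → ℕ) →
                        (∀ {x} (x∈p : x ∈ p) → lo ≤ f x∈p × f x∈p < hi) →
                        (∀ {x y} (x∈p : x ∈ p) (y∈p : y ∈ p) → f x∈p ≡ f y∈p → x ≡ y) →
                        ∣ p ∣ ≤ hi ∸ lo
injection-into-window {p = p} {lo} {hi} f in-window inj = injection⇒∣p∣≤n shifted shifted-injective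
  where
    shifted : ∀ {x} → x ∈ p → Fin (hi ∸ lo)
    shifted x∈p = fromℕ< (∸-monoˡ-< (proj₂ (in-window x∈p)) (proj₁ (in-window x∈p)))

    shifted-injective : ∀ {x y} (x∈p : x ∈ p) (y∈p : y ∈ p) → shifted x∈p ≡ shifted y∈p → x ≡ y
    shifted-injective x∈p y∈p e =
      inj x∈p y∈p (∸-cancelʳ-≡ (proj₁ (in-window x∈p)) (proj₁ (in-window y∈p))
                     (trans (sym (toℕ-fromℕ< _)) (trans (cong toℕ e) (toℕ-fromℕ< _))))

_⊆[_,_] : ∀ {n} → Subset n → Fin n → Fin n → Set
Y ⊆[ x , y ] = ∀ {w} → w ∈ Y → x Fin.≤ w × w Fin.≤ y

least : ∀ {n} {X : Subset n} → Nonempty X → ∃[ x ] (x ∈ X × ∀ {w} → w ∈ X → x Fin.≤ w)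
least {X = true  ∷ X} _                       = Fin.zero , here , λ _ → z≤n
least {X = false ∷ X} (Fin.suc e , there e∈X) =
  let x , x∈X , x≤ = least (e , e∈X) in Fin.suc x , there x∈X , λ { (there w∈X) → s≤s (x≤ w∈X) }

greatest : ∀ {n} {X : Subset n} → Nonempty X → ∃[ y ] (y ∈ X × ∀ {w} → w ∈ X → w Fin.≤ y)
greatest {X = b ∷ X} b∷X≢∅ with nonempty? X
... | yes X≢∅ = let y , y∈X , ≤y = greatest X≢∅ in
  Fin.suc y , there y∈X , λ { {Fin.zero} _ → z≤n ; (there w∈X) → s≤s (≤y w∈X) }
... | no  X≡∅ = Fin.zero , head∈ b∷X≢∅ , λ { {Fin.zero} _ → z≤n ; (there w∈X) → ⊥-elim (X≡∅ (_ , w∈X)) }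
  where
    head∈ : Nonempty (b ∷ X) → Fin.zero ∈ b ∷ X
    head∈ (Fin.zero  , here)      = here
    head∈ (Fin.suc w , there w∈X) = ⊥-elim (X≡∅ (w , w∈X))

bounds : ∀ {n} {X : Subset n} → Nonempty X → ∃₂ λ x y → x ∈ X × y ∈ X × X ⊆[ x , y ]
bounds X≢∅ =
  let x , x∈X , x≤ = least X≢∅
      y , y∈X , ≤y = greatest X≢∅
  in x , y , x∈X , y∈X , λ w∈X → x≤ w∈X , ≤y w∈X

-- Heights of lattice paths

ups-zero : ∀ {n} (v : Vec Bool n) → ups v 0 ≡ 0
ups-zero []      = refl
ups-zero (_ ∷ _) = refl

ups-suc : ∀ {n} (v : Vec Bool n) (j : Fin n) → ups v (suc (toℕ j)) ≡ ups v (toℕ j) + bit (lookup v j)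
ups-suc (b ∷ v) Fin.zero    = trans (cong (bit b +_) (ups-zero v)) (+-identityʳ (bit b))
ups-suc (b ∷ v) (Fin.suc j) = trans (cong (bit b +_) (ups-suc v j)) (sym (+-assoc (bit b) (ups v (toℕ j)) _))

ups-unitStep : ∀ {n} (v : Vec Bool n) t → UnitStep (ups v t) (ups v (suc t))
ups-unitStep []          t       = z≤n , z≤n
ups-unitStep (true ∷ v)  zero    = z≤n , s≤s (≤-reflexive (ups-zero v))
ups-unitStep (false ∷ v) zero    = z≤n , ≤-trans (≤-reflexive (ups-zero v)) z≤n
ups-unitStep (true ∷ v)  (suc t) = Product.map s≤s s≤s (ups-unitStep v t)
ups-unitStep (false ∷ v) (suc t) = ups-unitStep v t

ups-mono : ∀ {n} (v : Vec Bool n) {k k′} → k ≤ k′ → ups v k ≤ ups v k′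
ups-mono []      _          = ≤-refl
ups-mono (b ∷ v) z≤n        = z≤n
ups-mono (b ∷ v) (s≤s k≤k′) = +-monoʳ-≤ (bit b) (ups-mono v k≤k′)

ups-saturates : ∀ {n} (v : Vec Bool n) {k} → n ≤ k → ups v k ≡ ups v n
ups-saturates []      _         = refl
ups-saturates (b ∷ v) (s≤s n≤k) = cong (bit b +_) (ups-saturates v n≤k)

ups≤ups-length : ∀ {n} (v : Vec Bool n) k → ups v k ≤ ups v n
ups≤ups-length {n} v k with ≤-total k n
... | inj₁ k≤n = ups-mono v k≤n
... | inj₂ n≤k = ≤-reflexive (ups-saturates v n≤k)

notAbove-within : ∀ {n} (u v : Vec Bool n) → (∀ k → k ≤ n → ups u k ≤ ups v k) → NotAbove u v
notAbove-within {n} u v below k with ≤-total k n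
... | inj₁ k≤n = below k k≤n
... | inj₂ n≤k = subst₂ _≤_ (sym (ups-saturates u n≤k)) (sym (ups-saturates v n≤k)) (below n ≤-refl)

pathWithHeights : ∀ {n} → (ℕ → ℕ) → Vec Bool n
pathWithHeights h = tabulate λ s → does (h (suc (toℕ s)) ≟ suc (h (toℕ s)))

module _ {n : ℕ} (h : ℕ → ℕ) (h-zero : h 0 ≡ 0) (h-unitStep : ∀ t → UnitStep (h t) (h (suc t))) where

  private
    R : Vec Bool n
    R = pathWithHeights h

    ups-step : ∀ (s : Fin n) → ups R (toℕ s) ≡ h (toℕ s) → ups R (suc (toℕ s)) ≡ h (suc (toℕ s))
    ups-step s R-s≡h-s = begin
      ups R (suc (toℕ s))
        ≡⟨ ups-suc R s ⟩
      ups R (toℕ s) + bit (lookup R s)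
        ≡⟨ cong₂ (λ a b → a + bit b) R-s≡h-s (lookup∘tabulate _ s) ⟩
      h (toℕ s) + bit (does (h (suc (toℕ s)) ≟ suc (h (toℕ s))))
        ≡⟨ unitStep-bit (h-unitStep (toℕ s)) (_ ≟ _) ⟩
      h (suc (toℕ s))
        ∎
      where open ≡-Reasoning

  ups-pathWithHeights : ∀ t → t ≤ n → ups R t ≡ h t
  ups-pathWithHeights zero    _   = trans (ups-zero R) (sym h-zero)
  ups-pathWithHeights (suc t) t<n =
    subst (λ k → ups R (suc k) ≡ h (suc k)) (toℕ-fromℕ< t<n)
      (ups-step (fromℕ< t<n)
        (subst (λ k → ups R k ≡ h k) (sym (toℕ-fromℕ< t<n)) (ups-pathWithHeights t (≤-trans (n≤1+n t) t<n))))

  lookup-pathWithHeights : ∀ s → h (suc (toℕ s)) ≡ suc (h (toℕ s)) → lookup R s ≡ true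
  lookup-pathWithHeights s up = trans (lookup∘tabulate _ s) (dec-true (_ ≟ _) up)

module ClampedPath {n : ℕ} (P Q : Vec Bool n) (P≤Q : NotAbove P Q)
                   (G : ℕ → ℕ) (G-unitStep : ∀ t → UnitStep (G t) (G (suc t))) where

  height : ℕ → ℕ
  height t = ups Q t ⊓ (ups P t ⊔ G t)

  private
    height-zero : height 0 ≡ 0
    height-zero = cong (_⊓ (ups P 0 ⊔ G 0)) (ups-zero Q)

    height-unitStep : ∀ t → UnitStep (height t) (height (suc t))
    height-unitStep t = ⊓-unitStep (ups-unitStep Q t) (⊔-unitStep (ups-unitStep P t) (G-unitStep t))

  path : Vec Bool n
  path = pathWithHeights height

  ups-path : ∀ t → t ≤ n → ups path t ≡ height t
  ups-path = ups-pathWithHeights height height-zero height-unitStep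

  lookup-path : ∀ s → height (suc (toℕ s)) ≡ suc (height (toℕ s)) → lookup path s ≡ true
  lookup-path = lookup-pathWithHeights height height-zero height-unitStep

  P≤path : NotAbove P path
  P≤path = notAbove-within P path λ t t≤n →
    subst (ups P t ≤_) (sym (ups-path t t≤n)) (⊓-glb (P≤Q t) (m≤m⊔n _ _))

  path≤Q : NotAbove path Q
  path≤Q = notAbove-within path Q λ t t≤n →
    subst (_≤ ups Q t) (sym (ups-path t t≤n)) (m⊓n≤m _ _)

  ups-path-end : ups P n ≡ ups Q n → ups path n ≡ ups Q n
  ups-path-end P-n≡Q-n =
    trans (ups-path n ≤-refl) (trans (cong (λ p → ups Q n ⊓ (p ⊔ G n)) P-n≡Q-n) (m≤n⇒m⊓n≡m (m≤m⊔n _ _)))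

-- Hall's theorem for intervals with monotone endpoints

Monotone : ∀ {n} → (Fin n → ℕ) → Set
Monotone f = f Preserves Fin._≤_ ⟶ _≤_

record Transversal {n} (β α : Fin n → ℕ) (S : Subset n) : Set where
  field
    value     : Fin n → ℕ
    in-range  : ∀ {w} → w ∈ S → β w ≤ value w × value w < α w
    injective : ∀ {w w′} → w ∈ S → w′ ∈ S → value w ≡ value w′ → w ≡ w′

record OverfullWindow {n} (β α : Fin n → ℕ) (S : Subset n) : Set where
  field
    T        : Subset n
    T⊆S      : T ⊆ S
    lo hi    : ℕ
    inside   : ∀ {w} → w ∈ T → lo ≤ β w × α w ≤ hi
    overfull : hi ∸ lo < ∣ T ∣

-- The lower ends left for the other elements once the first one has greedily taken the value β 0.
raisedTail : ∀ {n} → (Fin (suc n) → ℕ) → Fin n → ℕ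
raisedTail β w = suc (β Fin.zero) ⊔ β (Fin.suc w)

raisedTail-mono : ∀ {n} {β : Fin (suc n) → ℕ} → Monotone β → Monotone (raisedTail β)
raisedTail-mono β-mono = ⊔-monoʳ-≤ _ ∘ β-mono ∘ s≤s

module _ {n} {β α : Fin (suc n) → ℕ} {S : Subset n} where

  transversal-skip : Transversal (β ∘ Fin.suc) (α ∘ Fin.suc) S → Transversal β α (false ∷ S)
  transversal-skip t = record
    { value     = λ { Fin.zero → 0 ; (Fin.suc w) → value w }
    ; in-range  = λ { (there w∈S) → in-range w∈S }
    ; injective = λ { (there w∈S) (there w′∈S) e → cong Fin.suc (injective w∈S w′∈S e) }
    }
    where open Transversal t

  overfull-skip : OverfullWindow (β ∘ Fin.suc) (α ∘ Fin.suc) S → OverfullWindow β α (false ∷ S)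
  overfull-skip o = record
    { T = false ∷ T ; T⊆S = λ { (there w∈T) → there (T⊆S w∈T) } ; lo = lo ; hi = hi
    ; inside = λ { (there w∈T) → inside w∈T } ; overfull = overfull
    }
    where open OverfullWindow o

  overfull-head : ¬ β Fin.zero < α Fin.zero → OverfullWindow β α (true ∷ S)
  overfull-head β₀≮α₀ = record
    { T = ⁅ Fin.zero ⁆ ; T⊆S = λ { here → here ; (there w∈⊥) → ⊥-elim (∉⊥ w∈⊥) }
    ; lo = β Fin.zero ; hi = α Fin.zero
    ; inside = λ { here → ≤-refl , ≤-refl ; (there w∈⊥) → ⊥-elim (∉⊥ w∈⊥) }
    ; overfull = s≤s (≤-trans (≤-reflexive (m≤n⇒m∸n≡0 (≮⇒≥ β₀≮α₀))) z≤n)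
    }

  transversal-cons : β Fin.zero < α Fin.zero → Transversal (raisedTail β) (α ∘ Fin.suc) S →
                     Transversal β α (true ∷ S)
  transversal-cons β₀<α₀ t = record
    { value     = value₀
    ; in-range  = λ { here → ≤-refl , β₀<α₀
                    ; (there w∈S) → ≤-trans (m≤n⊔m _ _) (proj₁ (in-range w∈S)) , proj₂ (in-range w∈S) }
    ; injective = λ { here here _ → refl
                    ; here (there w∈S) e → ⊥-elim (<-irrefl e (β₀<value w∈S))
                    ; (there w∈S) here e → ⊥-elim (<-irrefl (sym e) (β₀<value w∈S))
                    ; (there w∈S) (there w′∈S) e → cong Fin.suc (injective w∈S w′∈S e) }
    }
    where
      open Transversal t

      value₀ : Fin (suc n) → ℕ
      value₀ Fin.zero    = β Fin.zero
      value₀ (Fin.suc w) = value w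

      β₀<value : ∀ {w} → w ∈ S → β Fin.zero < value w
      β₀<value {w} w∈S = ≤-trans (m≤m⊔n (suc (β Fin.zero)) (β (Fin.suc w))) (proj₁ (in-range w∈S))

  overfull-cons : Monotone β → Monotone α → OverfullWindow (raisedTail β) (α ∘ Fin.suc) S →
                  OverfullWindow β α (true ∷ S)
  overfull-cons β-mono α-mono o with OverfullWindow.lo o ≤? suc (β Fin.zero)
  ... | yes lo≤1+β₀ = record
    { T = true ∷ T ; T⊆S = λ { here → here ; (there w∈T) → there (T⊆S w∈T) } ; lo = β Fin.zero ; hi = hi
    ; inside = λ { here → ≤-refl , α₀≤hi ; (there w∈T) → β-mono z≤n , proj₂ (inside w∈T) }
    ; overfull = s≤s (begin
        hi ∸ β Fin.zero              ≤⟨ [1+m]∸n≤1+[m∸n] hi (suc (β Fin.zero)) ⟩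
        suc (hi ∸ suc (β Fin.zero))  ≤⟨ s≤s (∸-monoʳ-≤ hi lo≤1+β₀) ⟩
        suc (hi ∸ lo)                ≤⟨ overfull ⟩
        ∣ T ∣                        ∎)
    }
    where
      open OverfullWindow o
      open ≤-Reasoning

      α₀≤hi : α Fin.zero ≤ hi
      α₀≤hi = let w , w∈T = 0<∣p∣⇒Nonempty (<-≤-trans z<s overfull) in
              ≤-trans (α-mono z≤n) (proj₂ (inside w∈T))
  ... | no lo≰1+β₀ = record
    { T = false ∷ T ; T⊆S = λ { (there w∈T) → there (T⊆S w∈T) } ; lo = lo ; hi = hi
    ; inside = λ { (there w∈T) → m≤n⊔o∧m≰n⇒m≤o (proj₁ (inside w∈T)) lo≰1+β₀ , proj₂ (inside w∈T) }
    ; overfull = overfull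
    }
    where open OverfullWindow o

transversal-or-overfull : ∀ {n} {β α : Fin n → ℕ} → Monotone β → Monotone α →
                          (S : Subset n) → Transversal β α S ⊎ OverfullWindow β α S
transversal-or-overfull _ _ [] = inj₁ record { value = λ () ; in-range = λ () ; injective = λ () }
transversal-or-overfull β-mono α-mono (false ∷ S) =
  Sum.map transversal-skip overfull-skip (transversal-or-overfull (β-mono ∘ s≤s) (α-mono ∘ s≤s) S)
transversal-or-overfull {β = β} {α} β-mono α-mono (true ∷ S) with β Fin.zero <? α Fin.zero
... | no  β₀≮α₀ = inj₂ (overfull-head β₀≮α₀)
... | yes β₀<α₀ =
  Sum.map (transversal-cons β₀<α₀) (overfull-cons β-mono α-mono)
          (transversal-or-overfull (raisedTail-mono β-mono) (α-mono ∘ s≤s) S)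

-- The lattice path matroid M[P,Q]

module LPM-Properties (m r : ℕ) (P Q : Vec Bool (m + r))
                      (P-path : IsPath m r P) (Q-path : IsPath m r Q) (P≤Q : NotAbove P Q) where
  open LPM m r P Q

  β α : Fin E → ℕ
  β j = ups P (toℕ j)
  α j = ups Q (suc (toℕ j))

  β-mono : Monotone β
  β-mono = ups-mono P

  α-mono : Monotone α
  α-mono = ups-mono Q ∘ s≤s

  α≤r : ∀ j → α j ≤ r
  α≤r j = ≤-trans (ups≤ups-length Q _) (≤-reflexive Q-path)

  inN⇒window : ∀ {i j} → InN m r P Q i j → β j ≤ toℕ i × toℕ i < α j
  inN⇒window {i} {j} (R , (_ , P≤R , R≤Q) , (j-north , R-j≡i)) =
    ≤-trans (P≤R (toℕ j)) (≤-reflexive R-j≡i) , ≤-trans (≤-reflexive R-1+j≡1+i) (R≤Q (suc (toℕ j)))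
    where
      R-1+j≡1+i : suc (toℕ i) ≡ ups R (suc (toℕ j))
      R-1+j≡1+i = sym (trans (ups-suc R j) (trans (cong₂ (λ a b → a + bit b) R-j≡i j-north) (+-comm (toℕ i) 1)))

  window⇒inN : ∀ {i j} → β j ≤ toℕ i → toℕ i < α j → InN m r P Q i j
  window⇒inN {i} {j} βj≤i i<αj = path , (R-path , P≤path , path≤Q) , (R-j-north , R-j≡i)
    where
      -- The witness stays at height i until step j and then goes North, as far as P and Q allow.
      G : ℕ → ℕ
      G t = toℕ i + (t ∸ toℕ j)

      G-unitStep : ∀ t → UnitStep (G t) (G (suc t))
      G-unitStep t = +-monoʳ-≤ (toℕ i) (∸-monoˡ-≤ (toℕ j) (n≤1+n t)) ,
                     ≤-trans (+-monoʳ-≤ (toℕ i) ([1+m]∸n≤1+[m∸n] t (toℕ j))) (≤-reflexive (+-suc (toℕ i) _))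

      open ClampedPath P Q P≤Q G G-unitStep

      height-j : height (toℕ j) ≡ toℕ i
      height-j = trans (cong (λ g → ups Q (toℕ j) ⊓ (ups P (toℕ j) ⊔ g)) G-j)
                       (m≤o≤n⇒n⊓[m⊔o]≡o βj≤i (s≤s⁻¹ (≤-trans i<αj (proj₂ (ups-unitStep Q (toℕ j))))))
        where
          G-j : G (toℕ j) ≡ toℕ i
          G-j = trans (cong (toℕ i +_) (n∸n≡0 (toℕ j))) (+-identityʳ (toℕ i))

      height-1+j : height (suc (toℕ j)) ≡ suc (toℕ i)
      height-1+j = trans (cong (λ g → ups Q (suc (toℕ j)) ⊓ (ups P (suc (toℕ j)) ⊔ g)) G-1+j)
                         (m≤o≤n⇒n⊓[m⊔o]≡o (≤-trans (proj₂ (ups-unitStep P (toℕ j))) (s≤s βj≤i)) i<αj)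
        where
          G-1+j : G (suc (toℕ j)) ≡ suc (toℕ i)
          G-1+j = trans (cong (toℕ i +_) (m+n∸n≡m 1 (toℕ j))) (+-comm (toℕ i) 1)

      R-path : IsPath m r path
      R-path = trans (ups-path-end (trans P-path (sym Q-path))) Q-path

      R-j-north : lookup path j ≡ true
      R-j-north = lookup-path j (trans height-1+j (cong suc (sym height-j)))

      R-j≡i : ups path (toℕ j) ≡ toℕ i
      R-j≡i = trans (ups-path (toℕ j) (<⇒≤ (toℕ<n j))) height-j

  inN? : ∀ i j → Dec (InN m r P Q i j)
  inN? i j = map′ (λ (βj≤i , i<αj) → window⇒inN βj≤i i<αj) inN⇒window ((β j ≤? toℕ i) ×-dec (toℕ i <? α j))

  indep-⊆ : ∀ {I J} → J ⊆ I → Indep I → Indep J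
  indep-⊆ J⊆I (f , f∈N , f-inj) =
    (λ x x∈J → f x (J⊆I x∈J)) , (λ x x∈J → f∈N x (J⊆I x∈J)) , λ x y x∈J y∈J → f-inj x y (J⊆I x∈J) (J⊆I y∈J)

  indep-∅ : ∀ {I} → (∀ {x} → x ∉ I) → Indep I
  indep-∅ ∉I = (λ _ x∈I → ⊥-elim (∉I x∈I)) , (λ _ x∈I → ⊥-elim (∉I x∈I)) , λ _ _ x∈I _ _ → ⊥-elim (∉I x∈I)

  dependent⇒nonempty : ∀ {X} → Dependent X → Nonempty X
  dependent⇒nonempty {X} X-dep with nonempty? X
  ... | yes X≢∅ = X≢∅
  ... | no  X≡∅ = ⊥-elim (X-dep (indep-∅ λ x∈X → X≡∅ (_ , x∈X)))

  rank-unique : ∀ {X k k′} → IsRank X k → IsRank X k′ → k ≡ k′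
  rank-unique ((I , I⊆X , I-indep , ∣I∣≡k) , maximum) ((I′ , I′⊆X , I′-indep , ∣I′∣≡k′) , maximum′) =
    ≤-antisym (subst (_≤ _) ∣I∣≡k (maximum′ I I⊆X I-indep)) (subst (_≤ _) ∣I′∣≡k′ (maximum I′ I′⊆X I′-indep))

  circuit⊆dependent : ∀ {C T} → IsCircuit C → T ⊆ C → Dependent T → C ⊆ T
  circuit⊆dependent {C} {T} (_ , minimal) T⊆C T-dep {c} c∈C with c ∈? T
  ... | yes c∈T = c∈T
  ... | no  c∉T = ⊥-elim (T-dep (indep-⊆ T⊆C-c (minimal c c∈C)))
    where
      T⊆C-c : T ⊆ C - c
      T⊆C-c x∈T = x∈p∧x≢y⇒x∈p-y (T⊆C x∈T) λ { refl → c∉T x∈T }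

  ∣indep∣≤window : ∀ {I lo hi} → Indep I → (∀ {e} → e ∈ I → lo ≤ β e × α e ≤ hi) → ∣ I ∣ ≤ hi ∸ lo
  ∣indep∣≤window {I} {lo} {hi} (f , f∈N , f-inj) within =
    injection-into-window (λ {x} x∈I → toℕ (f x x∈I)) in-window λ x∈I y∈I e → f-inj _ _ x∈I y∈I (toℕ-injective e)
    where
      in-window : ∀ {x} (x∈I : x ∈ I) → lo ≤ toℕ (f x x∈I) × toℕ (f x x∈I) < hi
      in-window x∈I = let βx≤fx , fx<αx = inN⇒window (f∈N _ x∈I)
                          lo≤βx , αx≤hi = within x∈I
                      in ≤-trans lo≤βx βx≤fx , ≤-trans fx<αx αx≤hi

  ∣indep∣≤span : ∀ {I x y} → I ⊆[ x , y ] → Indep I → ∣ I ∣ ≤ α y ∸ β x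
  ∣indep∣≤span I⊆[x,y] I-indep =
    ∣indep∣≤window I-indep λ e∈I → β-mono (proj₁ (I⊆[x,y] e∈I)) , α-mono (proj₂ (I⊆[x,y] e∈I))

  transversal⇒indep : ∀ {S} → Transversal β α S → Indep S
  transversal⇒indep {S} t = index , index∈N , index-injective
    where
      open Transversal t

      index : ∀ x → x ∈ S → Fin r
      index x x∈S = fromℕ< (≤-trans (proj₂ (in-range x∈S)) (α≤r x))

      index∈N : ∀ x x∈S → InN m r P Q (index x x∈S) x
      index∈N x x∈S = let βx≤v , v<αx = in-range x∈S in
        window⇒inN (subst (β x ≤_) (sym (toℕ-fromℕ< _)) βx≤v) (subst (_< α x) (sym (toℕ-fromℕ< _)) v<αx)

      index-injective : ∀ x y x∈S y∈S → index x x∈S ≡ index y y∈S → x ≡ y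
      index-injective x y x∈S y∈S e =
        injective x∈S y∈S (trans (sym (toℕ-fromℕ< _)) (trans (cong toℕ e) (toℕ-fromℕ< _)))

  circuit-overfull : ∀ {C} → IsCircuit C →
                     ∃₂ λ lo hi → (∀ {c} → c ∈ C → lo ≤ β c × α c ≤ hi) × hi ∸ lo < ∣ C ∣
  circuit-overfull {C} circuit with transversal-or-overfull β-mono α-mono C
  ... | inj₁ t = ⊥-elim (proj₁ circuit (transversal⇒indep t))
  ... | inj₂ o = lo , hi , inside ∘ C⊆T , ≤-trans overfull (p⊆q⇒∣p∣≤∣q∣ T⊆S)
    where
      open OverfullWindow o

      C⊆T : C ⊆ T
      C⊆T = circuit⊆dependent circuit T⊆S λ T-indep → <⇒≱ overfull (∣indep∣≤window T-indep inside)

  indep-split : ∀ {A B C} (i : Fin r) → (∀ {c} → c ∈ C → ¬ InN m r P Q i c) →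
                (∀ {c} → c ∈ C → α c ≤ toℕ i → c ∈ A) → (∀ {c} → c ∈ C → toℕ i < β c → c ∈ B) →
                Indep A → Indep B → Indep C
  indep-split {A} {B} {C} i i∉n[C] low⊆A high⊆B (f , f∈N , f-inj) (g , g∈N , g-inj) =
    (λ c c∈C → index c∈C (side c∈C)) , (λ c c∈C → index∈N c∈C (side c∈C)) ,
    λ c c′ c∈C c′∈C → index-injective c∈C c′∈C (side c∈C) (side c′∈C)
    where
      Side : Fin E → Set
      Side c = α c ≤ toℕ i ⊎ toℕ i < β c

      side : ∀ {c} → c ∈ C → Side c
      side {c} c∈C with α c ≤? toℕ i
      ... | yes αc≤i = inj₁ αc≤i
      ... | no  αc≰i = inj₂ (≰⇒> λ βc≤i → i∉n[C] c∈C (window⇒inN βc≤i (≰⇒> αc≰i)))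

      index : ∀ {c} → c ∈ C → Side c → Fin r
      index c∈C (inj₁ low)  = f _ (low⊆A c∈C low)
      index c∈C (inj₂ high) = g _ (high⊆B c∈C high)

      index∈N : ∀ {c} (c∈C : c ∈ C) s → InN m r P Q (index c∈C s) c
      index∈N c∈C (inj₁ low)  = f∈N _ _
      index∈N c∈C (inj₂ high) = g∈N _ _

      low<high : ∀ {c c′} (c∈C : c ∈ C) (c′∈C : c′ ∈ C) low high →
                 toℕ (index c∈C (inj₁ low)) < toℕ (index c′∈C (inj₂ high))
      low<high c∈C c′∈C low high =
        <-trans (≤-trans (proj₂ (inN⇒window (f∈N _ _))) low) (<-≤-trans high (proj₁ (inN⇒window (g∈N _ _))))

      index-injective : ∀ {c c′} (c∈C : c ∈ C) (c′∈C : c′ ∈ C) s s′ → index c∈C s ≡ index c′∈C s′ → c ≡ c′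
      index-injective c∈C c′∈C (inj₁ _)    (inj₁ _)    e = f-inj _ _ _ _ e
      index-injective c∈C c′∈C (inj₂ _)    (inj₂ _)    e = g-inj _ _ _ _ e
      index-injective c∈C c′∈C (inj₁ low)  (inj₂ high) e =
        ⊥-elim (<-irrefl (cong toℕ e) (low<high c∈C c′∈C low high))
      index-injective c∈C c′∈C (inj₂ high) (inj₁ low)  e =
        ⊥-elim (<-irrefl (cong toℕ (sym e)) (low<high c′∈C c∈C low high))

  circuit-through-ends : ∀ {X x y} → Connected X → Dependent X → x ∈ X → y ∈ X → X ⊆[ x , y ] →
                         ∃[ C ] (C ⊆ X × IsCircuit C × x ∈ C × y ∈ C)
  circuit-through-ends {X} {x} {y} connected X-dep x∈X y∈X X⊆[x,y] with x Fin.≟ y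
  ... | no  x≢y  = connected x y x∈X y∈X x≢y
  ... | yes refl = ⁅ x ⁆ , ⁅x⁆⊆X , (X-dep ∘ indep-⊆ X⊆⁅x⁆ , ⁅x⁆-minimal) , x∈⁅x⁆ x , x∈⁅x⁆ x
    where
      ⁅x⁆⊆X : ⁅ x ⁆ ⊆ X
      ⁅x⁆⊆X w∈⁅x⁆ rewrite x∈⁅y⁆⇒x≡y x w∈⁅x⁆ = x∈X

      X⊆⁅x⁆ : X ⊆ ⁅ x ⁆
      X⊆⁅x⁆ w∈X rewrite toℕ-injective (≤-antisym (proj₂ (X⊆[x,y] w∈X)) (proj₁ (X⊆[x,y] w∈X))) = x∈⁅x⁆ x

      ⁅x⁆-minimal : ∀ e → e ∈ ⁅ x ⁆ → Indep (⁅ x ⁆ - e)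
      ⁅x⁆-minimal e e∈⁅x⁆ rewrite x∈⁅y⁆⇒x≡y x e∈⁅x⁆ = indep-∅ λ w∈⁅x⁆-x →
        x∉p-x ⁅ x ⁆ x (subst (_∈ ⁅ x ⁆ - x) (x∈⁅y⁆⇒x≡y x (p─q⊆p ⁅ x ⁆ ⁅ x ⁆ w∈⁅x⁆-x)) w∈⁅x⁆-x)

  module _ {C x y} (C-circuit : IsCircuit C) (x∈C : x ∈ C) (y∈C : y ∈ C) where

    private
      minimal : ∀ e → e ∈ C → Indep (C - e)
      minimal = proj₂ C-circuit

    incidence-of-circuit : ∀ i → β x ≤ toℕ i → toℕ i < α y → InIncidence C i
    incidence-of-circuit i βx≤i i<αy with any? (λ c → (c ∈? C) ×-dec inN? i c)
    ... | yes i∈n[C] = i∈n[C]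
    ... | no  i∉n[C] = ⊥-elim (proj₁ C-circuit
            (indep-split i (λ c∈C i∈Nc → i∉n[C] (_ , c∈C , i∈Nc)) low⊆C-y high⊆C-x (minimal y y∈C) (minimal x x∈C)))
      where
        low⊆C-y : ∀ {c} → c ∈ C → α c ≤ toℕ i → c ∈ C - y
        low⊆C-y c∈C αc≤i = x∈p∧x≢y⇒x∈p-y c∈C λ { refl → <⇒≱ i<αy αc≤i }

        high⊆C-x : ∀ {c} → c ∈ C → toℕ i < β c → c ∈ C - x
        high⊆C-x c∈C i<βc = x∈p∧x≢y⇒x∈p-y c∈C λ { refl → <⇒≱ i<βc βx≤i }

    span≤∣C-x∣ : α y ∸ β x ≤ ∣ C - x ∣
    span≤∣C-x∣ =
      let lo , hi , inside , overfull = circuit-overfull C-circuit in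
      s≤s⁻¹ (begin-strict
        α y ∸ β x      ≤⟨ ∸-mono (proj₂ (inside y∈C)) (proj₁ (inside x∈C)) ⟩
        hi ∸ lo        <⟨ overfull ⟩
        ∣ C ∣          ≤⟨ ∣p∣≤1+∣p-x∣ C x ⟩
        suc ∣ C - x ∣  ∎)
      where open ≤-Reasoning

    rank-between : ∀ {Y} → C ⊆ Y → Y ⊆[ x , y ] → IsRank Y (α y ∸ β x)
    rank-between {Y} C⊆Y Y⊆[x,y] =
      (C - x , C-x⊆Y , minimal x x∈C , ≤-antisym (∣indep∣≤span (Y⊆[x,y] ∘ C-x⊆Y) (minimal x x∈C)) span≤∣C-x∣) ,
      λ I I⊆Y → ∣indep∣≤span (Y⊆[x,y] ∘ I⊆Y)
      where
        C-x⊆Y : C - x ⊆ Y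
        C-x⊆Y = C⊆Y ∘ p─q⊆p C ⁅ x ⁆

    module _ {X} (X-flat : IsFlat X) (C⊆X : C ⊆ X) (X⊆[x,y] : X ⊆[ x , y ]) where

      flat-interval : IsInterval X
      flat-interval = toℕ x , toℕ y , λ j → mk⇔ X⊆[x,y] λ (x≤j , j≤y) → between⇒∈ j x≤j j≤y
        where
          between⇒∈ : ∀ j → x Fin.≤ j → j Fin.≤ y → j ∈ X
          between⇒∈ j x≤j j≤y with j ∈? X
          ... | yes j∈X = j∈X
          ... | no  j∉X =
            ⊥-elim (<-irrefl refl (X-flat j j∉X _ _ (rank-between C⊆X X⊆[x,y]) (rank-between C⊆X∪j X∪j⊆[x,y])))
            where
              C⊆X∪j : C ⊆ X ∪ ⁅ j ⁆
              C⊆X∪j = p⊆p∪q ⁅ j ⁆ ∘ C⊆X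

              X∪j⊆[x,y] : (X ∪ ⁅ j ⁆) ⊆[ x , y ]
              X∪j⊆[x,y] w∈X∪j with x∈p∪q⁻ X ⁅ j ⁆ w∈X∪j
              ... | inj₁ w∈X   = X⊆[x,y] w∈X
              ... | inj₂ w∈⁅j⁆ rewrite x∈⁅y⁆⇒x≡y j w∈⁅j⁆ = x≤j , j≤y

      flat-incidence : ∀ k → IsRank X k → IncidenceIntervalOfSize X k
      flat-incidence k X-rank rewrite rank-unique X-rank (rank-between C⊆X X⊆[x,y]) =
        β x , λ i → mk⇔ (λ (j , j∈X , i∈Nj) → in-window i j∈X i∈Nj) (λ (βx≤i , i<) → covered i βx≤i i<)
        where
          in-window : ∀ i {j} → j ∈ X → InN m r P Q i j → β x ≤ toℕ i × toℕ i < β x + (α y ∸ β x)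
          in-window i j∈X i∈Nj =
            let βj≤i , i<αj = inN⇒window i∈Nj
                x≤j , j≤y = X⊆[x,y] j∈X
                βx≤i = ≤-trans (β-mono x≤j) βj≤i
            in βx≤i , Equivalence.to (m≤o⇒[o<n⇔o<m+[n∸m]] βx≤i) (≤-trans i<αj (α-mono j≤y))

          covered : ∀ i → β x ≤ toℕ i → toℕ i < β x + (α y ∸ β x) → InIncidence X i
          covered i βx≤i i< =
            let c , c∈C , i∈Nc = incidence-of-circuit i βx≤i (Equivalence.from (m≤o⇒[o<n⇔o<m+[n∸m]] βx≤i) i<)
            in c , C⊆X c∈C , i∈Nc

theorem3p11 : (m r : ℕ) (P Q : Vec Bool (m + r)) →
    IsPath m r P → IsPath m r Q → NotAbove P Q →
    (X : Subset (m + r)) →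
    LPM.IsFlat m r P Q X → LPM.Connected m r P Q X → LPM.Dependent m r P Q X →
    LPM.IsInterval m r P Q X
      × (∀ k → LPM.IsRank m r P Q X k → LPM.IncidenceIntervalOfSize m r P Q X k)
theorem3p11 m r P Q P-path Q-path P≤Q X X-flat X-connected X-dep =
  let x , y , x∈X , y∈X , X⊆[x,y] = bounds (dependent⇒nonempty X-dep)
      C , C⊆X , C-circuit , x∈C , y∈C = circuit-through-ends X-connected X-dep x∈X y∈X X⊆[x,y]
  in flat-interval C-circuit x∈C y∈C X-flat C⊆X X⊆[x,y] , flat-incidence C-circuit x∈C y∈C X-flat C⊆X X⊆[x,y]
  where open LPM-Properties m r P Q P-path Q-path P≤Q
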